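{- Let $P$ be a logic program with $\mathit{At}(P)=\{x_1,\ldots,x_n\}$ and let $\pi$ be a permutation of $\{1,\ldots,n\}$. Consider the procedure $\mathit{stable\_aux}(P,\pi)$: for each clause $C$ initialize $p(C)$ to the number of atoms in $b^+(C)$ and $n(C)$ to the number of atoms in $b^-(C)$; for each atom $a$ let $\mathit{pos}(a)$ (resp. $\mathit{neg}(a)$) be the list of clauses containing $a$ (resp. $\mathrm{not}(a)$) in their bodies. (1) $M:=\mathit{At}(P)$; (2) $Q:=$ set of clauses $C$ with $p(C)=n(C)=0$; (3) $\mathit{lm}:=\emptyset$; (4) for $j=1$ to $n$ do: (5) while $Q\neq\emptyset$ do: (6) let $C_0$ be any clause in $Q$; (7) mark $C_0$ as used and remove it from $Q$; (8) if $h(C_0)\notin\mathit{lm}$ then (9) $\mathit{lm}:=\mathit{lm}\cup\{h(C_0)\}$ and (10) for each $C\in\mathit{pos}(h(C_0))$: (11) $p(C):=p(C)-1$; (12) if $p(C)=0$, $n(C)=0$ and $C$ not used, add $C$ to $Q$; (13) if $\mathit{lm}=M$ then output $M$ and stop; (14) $M:=M\setminus\{x_{\pi(j)}\}$; (15) for each $C\in\mathit{neg}(x_{\pi(j)})$: (16) $n(C):=n(C)-1$; (17) if $n(C)=0$, $p(C)=0$ and $C$ not used, add $C$ to $Q$. Then for every $j\in\{1,\ldots,n\}$, with $M=\{x_{\pi(j)},\ldots,x_{\pi(n)}\}$, the procedure $\mathit{stable\_aux}(P,\pi)$ outputs $M$ if and only if $M$ is a stable model of $P$. Moreover, $\mathit{stable\_aux}$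 runs in $O(m)$ steps, where $m$ is the size of $P$.
   Context: A clause is $p\leftarrow B$ with head atom $h(C)=p$ and body $B$ a finite set of literals (atoms $a$ or negated atoms $\mathrm{not}(a)$, no repetitions); $b^+(C)$ and $b^-(C)$ are the sets of atoms occurring positively, resp. negated, in the body. A logic program is a finite set of clauses, given in a standard linked-list representation; its size $m$ is the total number of occurrences of atoms. $\mathit{At}(P)$ is the set of atoms of $P$. $M\subseteq\mathit{At}(P)$ is a stable model of $P$ if $M$ is the least model of the Gelfond–Lifschitz reduct $P^M$, obtained by deleting every clause $C$ with $b^-(C)\cap M\neq\emptyset$ and deleting negated literals from the remaining clauses. -}

module Defs where

open import Data.Bool using (Bool; true; false; not; _∧_; if_then_else_)
import Data.Bool as B
open import Data.Nat using (ℕ; zero; suc; _+_; _∸_; _≡ᵇ_; _≤ᵇ_)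
open import Data.Fin using (Fin; toℕ)
import Data.Fin as F
open import Data.Fin.Subset using (Subset; ⊥; ⊤; ⁅_⁆; _∪_; _-_; _⊆_)
import Data.Fin.Subset as S
open import Data.Fin.Permutation using (Permutation′; _⟨$⟩ʳ_; _⟨$⟩ˡ_)
open import Data.List using (List; []; _∷_; length; map; filterᵇ; removeAt; lookup; allFin)
open import Data.Nat.ListAction using (sum)
open import Data.Bool.ListAction using (all; any)
open import Data.List.Relation.Unary.Any using (Any)
open import Data.List.Relation.Unary.Unique.Propositional using (Unique)
import Data.List.Membership.Propositional as LM
open import Data.Vec using (Vec; tabulate; updateAt)
import Data.Vec as V
open import Data.Vec.Properties using (≡-dec)
open import Data.Product using (_×_; _,_)
open import Data.Sum using (_⊎_)
open import Data.Maybe using (Maybe; just; nothing)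
open import Relation.Nullary using (does)
open import Relation.Binary.PropositionalEquality using (_≡_)

-- A clause  h ← b⁺ ∪ not(b⁻) ; the body is a set of literals without
-- repetitions, i.e. b⁺ and b⁻ are duplicate-free lists.
record Clause (n : ℕ) : Set where
  constructor clause
  field
    head    : Fin n
    posBody : List (Fin n)
    negBody : List (Fin n)
    posUniq : Unique posBody
    negUniq : Unique negBody
open Clause public

Program : ℕ → Set
Program n = List (Clause n)

Occurs : ∀ {n} → Fin n → Program n → Set
Occurs a P = Any (λ C → a ≡ head C ⊎ (a LM.∈ posBody C ⊎ a LM.∈ negBody C)) P

AtomsAre : ∀ {n} → Program n → Set
AtomsAre {n} P = (a : Fin n) → Occurs a P

size : ∀ {n} → Program n → ℕ
size P = sum (map (λ C → suc (length (posBody C) + length (negBody C))) P)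

record DefClause (n : ℕ) : Set where
  constructor defclause
  field
    dhead : Fin n
    dbody : List (Fin n)
open DefClause public

infix 4 _∈ᵇ_
_∈ᵇ_ : ∀ {n} → Fin n → Subset n → Bool
a ∈ᵇ M = V.lookup M a

reduct : ∀ {n} → Program n → Subset n → List (DefClause n)
reduct P M =
  map (λ C → defclause (head C) (posBody C))
      (filterᵇ (λ C → all (λ a → not (a ∈ᵇ M)) (negBody C)) P)

IsModel : ∀ {n} → List (DefClause n) → Subset n → Set
IsModel D N = ∀ C → C LM.∈ D → (∀ a → a LM.∈ dbody C → a S.∈ N) → dhead C S.∈ N

IsLeastModel : ∀ {n} → List (DefClause n) → Subset n → Set
IsLeastModel {n} D M = IsModel D M × (∀ (N : Subset n) → IsModel D N → M ⊆ N)

StableModel : ∀ {n} → Program n → Subset n → Set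
StableModel P M = IsLeastModel (reduct P M) M

-- {x_{π(j)}, …, x_{π(n)}}  (0-indexed: atoms π(i) with j ≤ i),
-- written via membership: a = π(i) with i = π⁻¹(a).
suffixSet : ∀ {n} → Permutation′ n → Fin n → Subset n
suffixSet π j = tabulate (λ a → toℕ j ≤ᵇ toℕ (π ⟨$⟩ˡ a))

-- Nondeterminism of line (6) ("let C₀ be any clause in Q") is resolved by an
-- arbitrary selector: given the number t of clauses popped so far and the
-- current (nonempty) queue x ∷ xs, it returns the position of C₀ in the queue.
-- Quantifying over all selectors covers every possible execution.

Selector : ℕ → Set
Selector k = ℕ → (x : Fin k) (xs : List (Fin k)) → Fin (suc (length xs))

-- Cost model: every executed line of the pseudocode costs one step
-- (including each test of a loop condition); the initialisation
-- (computing p(C), n(C), pos(a), neg(a), M := At(P), Q) costs one step per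
-- atom occurrence, per atom and per clause.

record State (n k : ℕ) : Set where
  constructor state
  field
    pc   : Vec ℕ k
    nc   : Vec ℕ k
    used : Vec Bool k
    Q    : List (Fin k)
    lm   : Subset n
    M    : Subset n
    t    : ℕ             -- number of clauses popped so far
    cost : ℕ
open State public

module StableAux {n : ℕ} (P : Program n) (π : Permutation′ n) (sel : Selector (length P)) where

  k : ℕ
  k = length P

  cl : Fin k → Clause n
  cl i = lookup P i

  memᵇ : Fin n → List (Fin n) → Bool
  memᵇ a xs = any (λ b → does (a F.≟ b)) xs

  posOf negOf : Fin n → List (Fin k)
  posOf a = filterᵇ (λ i → memᵇ a (posBody (cl i))) (allFin k)
  negOf a = filterᵇ (λ i → memᵇ a (negBody (cl i))) (allFin k)

  zeroᵇ : ℕ → Bool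
  zeroᵇ x = x ≡ᵇ 0

  ready : State n k → Fin k → Bool
  ready s c = zeroᵇ (V.lookup (pc s) c) ∧ zeroᵇ (V.lookup (nc s) c) ∧ not (V.lookup (used s) c)

  addIf : Fin k → State n k → State n k
  addIf c s = if ready s c then record s { Q = c ∷ Q s } else s

  -- lines (10)–(12)
  decPos : List (Fin k) → State n k → State n k
  decPos [] s = record s { cost = suc (cost s) }
  decPos (c ∷ cs) s =
    let s₁ = record s { pc = updateAt (pc s) c (_∸ 1) ; cost = 3 + cost s }
    in decPos cs (addIf c s₁)

  -- lines (15)–(17)
  decNeg : List (Fin k) → State n k → State n k
  decNeg [] s = record s { cost = suc (cost s) }
  decNeg (c ∷ cs) s =
    let s₁ = record s { nc = updateAt (nc s) c (_∸ 1) ; cost = 3 + cost s }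
    in decNeg cs (addIf c s₁)

  -- lines (5)–(12), with fuel k (each clause is popped at most once)
  whileQ : ℕ → State n k → State n k
  whileQ zero s = s
  whileQ (suc f) s with Q s
  ... | [] = record s { cost = suc (cost s) }
  ... | x ∷ xs =
    let i  = sel (t s) x xs
        c₀ = lookup (x ∷ xs) i
        h  = head (cl c₀)
        s₁ = record s { Q = removeAt (x ∷ xs) i
                      ; used = updateAt (used s) c₀ (λ _ → true)
                      ; t = suc (t s)
                      ; cost = 4 + cost s }     -- lines (5),(6),(7),(8)
    in if h ∈ᵇ lm s₁
       then whileQ f s₁
       else whileQ f (decPos (posOf h)
                        (record s₁ { lm = lm s₁ ∪ ⁅ h ⁆ ; cost = suc (cost s₁) }))

  _==_ : Subset n → Subset n → Bool
  A == B′ = does (≡-dec B._≟_ A B′)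

  -- lines (4)–(17); the argument lists x_{π(j)}, …, x_{π(n)}
  forLoop : List (Fin n) → State n k → Maybe (Subset n) × ℕ
  forLoop [] s = nothing , cost s
  forLoop (x ∷ xs) s =
    let s₁ = whileQ k (record s { cost = suc (cost s) })   -- line (4)
    in if lm s₁ == M s₁
       then (just (M s₁) , suc (cost s₁))                   -- line (13): output M, stop
       else forLoop xs (decNeg (negOf x)
                          (record s₁ { M = M s₁ - x ; cost = 2 + cost s₁ }))  -- (13),(14)

  initState : State n k
  initState = record
    { pc   = tabulate (λ i → length (posBody (cl i)))
    ; nc   = tabulate (λ i → length (negBody (cl i)))
    ; used = V.replicate k false
    ; Q    = filterᵇ (λ i → zeroᵇ (length (posBody (cl i))) ∧ zeroᵇ (length (negBody (cl i))))
                     (allFin k)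
    ; lm   = ⊥
    ; M    = ⊤
    ; t    = 0
    ; cost = size P + n + k }

  -- result: (output, number of steps); output = nothing if the procedure
  -- terminates without outputting a set.
  run : Maybe (Subset n) × ℕ
  run = forLoop (map (π ⟨$⟩ʳ_) (allFin n)) initState

stable-aux : ∀ {n} (P : Program n) → Permutation′ n → Selector (length P) → Maybe (Subset n) × ℕ
stable-aux P π sel = StableAux.run P π sel

{-# OPTIONS --safe #-}
-- stable_aux maintains an invariant: p(C) counts the atoms of b⁺(C) outside lm, n(C) the atoms of
-- b⁻(C) inside M, Q holds exactly the unused clauses with p(C) = n(C) = 0, used clauses have their
-- head in lm, and lm lies in every model of the reduct P^M.  Hence once the inner loop has emptied Q,
-- lm is closed under P^M, so it is the least model of P^M and the test lm = M of line (13) succeeds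
-- exactly when M is stable.  The candidates M are the sets {x_π(j), …, x_π(n)} in decreasing order,
-- and stable models form an ⊆-antichain, so no earlier candidate is output in place of a stable one.
-- The work of lines (5)–(12) and (15)–(17) is paid for by the potential
-- 3 Σ p(C) + 3 Σ n(C) + 4 #(unused clauses) + 2 #(atoms ∉ lm), which starts at most at 12 m; each
-- iteration of line (4) costs at most five further steps.
module Submission where

open import Defs
open import Data.Bool using (Bool; true; false; T; not; _∧_; if_then_else_)
open import Data.Bool.ListAction using (all)
import Data.Bool.Properties as Bool
open import Data.Bool.Properties using (T-≡; T-∧; ∧-identityʳ)
open import Data.Empty using (⊥-elim)
open import Data.Fin using (Fin; toℕ)
import Data.Fin as F
open import Data.Fin.Permutation using (Permutation′; _⟨$⟩ʳ_; _⟨$⟩ˡ_; inverseʳ; inverseˡ)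
open import Data.Fin.Properties using (toℕ<n; injective⇒≤)
open import Data.Fin.Subset using (Subset; ⊤; ⁅_⁆; _∪_; _-_; _⊆_; _⊂_; ∁; ∣_∣)
  renaming (_∈_ to _∈ₛ_; _∉_ to _∉ₛ_)
open import Data.Fin.Subset.Properties
  using (_∈?_; ∈⊤; ∉⊥; ⊥⊆; ⊆-antisym; p⊆p∪q; q⊆p∪q; x∈p∪q⁻; x∈⁅x⁆; x∈⁅y⁆⇒x≡y; ∣⁅x⁆∣≡1;
         p─q⊆p; x∈p∧x≢y⇒x∈p-y; x∉p⇒x∈∁p; ∣p∣≤n; p⊆q⇒∣p∣≤∣q∣; p⊂q⇒∣p∣<∣q∣; p⊂q⇒∁p⊃∁q)
open import Data.List using (List; []; _∷_; _++_; length; map; filter; filterᵇ; removeAt; lookup; allFin; drop)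
import Data.List.Properties as List
open import Data.List.Membership.Propositional using (_∈_; _∉_)
open import Data.List.Membership.Propositional.Properties
  using (∈-++⁺ˡ; ∈-++⁺ʳ; ∈-lookup; ∈-map⁺; ∈-map⁻; ∈-allFin; ∈-filter⁺; ∈-filter⁻; ∈-map∘filter⁺; ∈-map∘filter⁻)
open import Data.List.Relation.Unary.All as All using (All; []; _∷_)
open import Data.List.Relation.Unary.All.Properties using (all⁺; all⁻)
open import Data.List.Relation.Unary.AllPairs using ([]; _∷_)
open import Data.List.Relation.Unary.Any as Any using (here; there)
open import Data.List.Relation.Unary.Any.Properties using (lookup-index)
open import Data.List.Relation.Unary.Unique.Propositional using (Unique)
import Data.List.Relation.Unary.Unique.Propositional.Properties as Unique
open import Data.Maybe using (just)
open import Data.Maybe.Properties using (just-injective)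
open import Data.Nat using (ℕ; zero; suc; _+_; _*_; _∸_; _≤_; _<_; _≤ᵇ_; z≤n; s≤s; s≤s⁻¹)
open import Data.Nat.ListAction using (sum)
open import Data.Nat.Properties
  using (≡ᵇ⇒≡; ≡⇒≡ᵇ; ≤ᵇ⇒≤; ≤⇒≤ᵇ; +-suc; ≤-refl; ≤-reflexive; ≤-trans; <-≤-trans; n≤1+n; m≤n⇒m≤1+n;
         m≤m+n; m≤n+m; m≤m*n; +-mono-≤; +-monoˡ-≤; +-monoʳ-≤; *-monoʳ-≤; module ≤-Reasoning)
open import Data.Nat.Tactic.RingSolver using (solve-∀)
open import Data.Product using (_×_; _,_; proj₁; proj₂; ∃-syntax)
open import Data.Sum using (_⊎_; inj₁; inj₂)
open import Data.Vec using (Vec; _∷_; here; there; updateAt; _[_]≔_)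
import Data.Vec as V
open import Data.Vec.Properties
  using (≡-dec; lookup∘tabulate; lookup-replicate; lookup∘updateAt; lookup∘updateAt′;
         []=⇒lookup; lookup⇒[]=; []≔-updates; []≔-minimal)
open import Function using (_∘_; case_of_)
open import Function.Bundles using (_⇔_; mk⇔; Equivalence)
import Function.Properties.Equivalence as ⇔
open import Level using (0ℓ)
open import Relation.Binary.PropositionalEquality
open import Relation.Nullary using (¬_; ¬?; Dec; yes; no)
open import Relation.Nullary.Decidable using (T?; decidable-stable; dec-true; dec-false)
open import Relation.Unary using (Pred; Decidable)

private variable
  A : Set

module _ {P : Pred A 0ℓ} (P? : Decidable P) where

  count : List A → ℕ
  count xs = length (filter P? xs)

  count-all : ∀ {xs} → All P xs → count xs ≡ length xs
  count-all pxs = cong length (List.filter-all P? pxs)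

  count≡0⇔ : ∀ xs → count xs ≡ 0 ⇔ All (¬_ ∘ P) xs
  count≡0⇔ xs = mk⇔ (none xs) (cong length ∘ List.filter-none P?)
    where
      none : ∀ xs → count xs ≡ 0 → All (¬_ ∘ P) xs
      none []       _  = []
      none (x ∷ xs) eq with P? x
      ... | no ¬px = ¬px ∷ none xs eq

module _ {P Q : Pred A 0ℓ} (P? : Decidable P) (Q? : Decidable Q)
         {h : A} (agree : ∀ {x} → x ≢ h → P x ⇔ Q x) where

  private
    count-∷ : ∀ {x xs} d → x ≢ h → count P? xs ≡ d + count Q? xs → count P? (x ∷ xs) ≡ d + count Q? (x ∷ xs)
    count-∷ {x} {xs} d x≢h eq with P? x | Q? x
    ... | yes _  | yes _  = trans (cong suc eq) (sym (+-suc d (count Q? xs)))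
    ... | no  _  | no  _  = eq
    ... | yes px | no ¬qx = ⊥-elim (¬qx (Equivalence.to (agree x≢h) px))
    ... | no ¬px | yes qx = ⊥-elim (¬px (Equivalence.from (agree x≢h) qx))

  count-agree : ∀ {xs} → h ∉ xs → count P? xs ≡ count Q? xs
  count-agree {[]}     _  = refl
  count-agree {x ∷ xs} h∉ = count-∷ 0 (h∉ ∘ here ∘ sym) (count-agree (h∉ ∘ there))

  count-drop : P h → ¬ Q h → ∀ {xs} → Unique xs → h ∈ xs → count P? xs ≡ suc (count Q? xs)
  count-drop ph ¬qh {x ∷ xs} (h∉xs ∷ _) (here refl) with P? x | Q? x
  ... | yes _  | no _   = cong suc (count-agree (λ h∈ → All.lookup h∉xs h∈ refl))
  ... | no ¬ph | _      = ⊥-elim (¬ph ph)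
  ... | _      | yes qh = ⊥-elim (¬qh qh)
  count-drop ph ¬qh {x ∷ xs} (x∉xs ∷ u) (there h∈) =
    count-∷ 1 (All.lookup x∉xs h∈) (count-drop ph ¬qh u h∈)

∈-removeAt⁺ : ∀ {x : A} xs i → x ∈ xs → x ≢ lookup xs i → x ∈ removeAt xs i
∈-removeAt⁺ (y ∷ xs) F.zero    (here refl) x≢y = ⊥-elim (x≢y refl)
∈-removeAt⁺ (y ∷ xs) F.zero    (there x∈)  _   = x∈
∈-removeAt⁺ (y ∷ xs) (F.suc i) (here x≡y)  _   = here x≡y
∈-removeAt⁺ (y ∷ xs) (F.suc i) (there x∈)  x≢  = there (∈-removeAt⁺ xs i x∈ x≢)

∈-removeAt⁻ : ∀ {x : A} xs i → x ∈ removeAt xs i → x ∈ xs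
∈-removeAt⁻ (y ∷ xs) F.zero    x∈         = there x∈
∈-removeAt⁻ (y ∷ xs) (F.suc i) (here x≡y) = here x≡y
∈-removeAt⁻ (y ∷ xs) (F.suc i) (there x∈) = there (∈-removeAt⁻ xs i x∈)

lookup∉removeAt : ∀ {xs : List A} i → Unique xs → lookup xs i ∉ removeAt xs i
lookup∉removeAt {xs = y ∷ xs} F.zero    (y∉ ∷ _) y∈         = All.lookup y∉ y∈ refl
lookup∉removeAt {xs = y ∷ xs} (F.suc i) (y∉ ∷ _) (here eq)  = All.lookup y∉ (∈-lookup i) (sym eq)
lookup∉removeAt {xs = y ∷ xs} (F.suc i) (_ ∷ u)  (there x∈) = lookup∉removeAt i u x∈

Unique-removeAt : ∀ {xs : List A} i → Unique xs → Unique (removeAt xs i)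
Unique-removeAt {xs = y ∷ xs} F.zero    (_ ∷ u)  = u
Unique-removeAt {xs = y ∷ xs} (F.suc i) (y∉ ∷ u) =
  All.tabulate (All.lookup y∉ ∘ ∈-removeAt⁻ xs i) ∷ Unique-removeAt i u

∈-drop⁻ : ∀ {x : A} i xs → x ∈ drop i xs → x ∈ xs
∈-drop⁻ zero    xs       x∈ = x∈
∈-drop⁻ (suc i) (_ ∷ xs) x∈ = there (∈-drop⁻ i xs x∈)

drop-allFin-suc : ∀ {m} i → drop (suc i) (allFin (suc m)) ≡ map F.suc (drop i (allFin m))
drop-allFin-suc {m} i =
  trans (cong (drop i) (sym (List.map-tabulate (λ x → x) F.suc))) (List.drop-map i (allFin m))

∈-drop-allFin⁺ : ∀ {m} i {b : Fin m} → i ≤ toℕ b → b ∈ drop i (allFin m)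
∈-drop-allFin⁺ zero    {b}       _        = ∈-allFin b
∈-drop-allFin⁺ (suc i) {F.suc b} (s≤s i≤) =
  subst (F.suc b ∈_) (sym (drop-allFin-suc i)) (∈-map⁺ F.suc (∈-drop-allFin⁺ i i≤))

∈-drop-allFin⁻ : ∀ {m} i {b : Fin m} → b ∈ drop i (allFin m) → i ≤ toℕ b
∈-drop-allFin⁻ zero               _  = z≤n
∈-drop-allFin⁻ {suc m} (suc i) {b} b∈ with ∈-map⁻ F.suc (subst (b ∈_) (drop-allFin-suc i) b∈)
... | b′ , b′∈ , refl = s≤s (∈-drop-allFin⁻ i b′∈)

sum-tabulate-lookup : ∀ (f : A → ℕ) xs → V.sum (V.tabulate (f ∘ lookup xs)) ≡ sum (map f xs)
sum-tabulate-lookup f []       = refl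
sum-tabulate-lookup f (x ∷ xs) = cong (f x +_) (sum-tabulate-lookup f xs)

sum-map-mono : ∀ {f g : A → ℕ} → (∀ x → f x ≤ g x) → ∀ xs → sum (map f xs) ≤ sum (map g xs)
sum-map-mono f≤g []       = z≤n
sum-map-mono f≤g (x ∷ xs) = +-mono-≤ (f≤g x) (sum-map-mono f≤g xs)

sum-decrement : ∀ {m} (v : Vec ℕ m) i → V.lookup v i ≢ 0 → V.sum v ≡ suc (V.sum (updateAt v i (_∸ 1)))
sum-decrement (zero  ∷ v) F.zero    nz = ⊥-elim (nz refl)
sum-decrement (suc x ∷ v) F.zero    _  = refl
sum-decrement (x     ∷ v) (F.suc i) nz = trans (cong (x +_) (sum-decrement v i nz)) (+-suc x _)

∈⇔T : ∀ {m} {x : Fin m} {p} → x ∈ₛ p ⇔ T (x ∈ᵇ p)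
∈⇔T {x = x} {p} = mk⇔ (Equivalence.from T-≡ ∘ []=⇒lookup) (lookup⇒[]= x p ∘ Equivalence.to T-≡)

∉⇔T-not : ∀ {m} {x : Fin m} {p} → x ∉ₛ p ⇔ T (not (x ∈ᵇ p))
∉⇔T-not {x = x} {p} = mk⇔ to from
  where
    to : x ∉ₛ p → T (not (x ∈ᵇ p))
    to x∉ with x ∈ᵇ p in eq
    ... | true  = x∉ (lookup⇒[]= x p eq)
    ... | false = _
    from : T (not (x ∈ᵇ p)) → x ∉ₛ p
    from t x∈ rewrite []=⇒lookup x∈ = t

x∉p-x : ∀ {m} (p : Subset m) x → x ∉ₛ p - x
x∉p-x (_ ∷ p) F.zero    ()
x∉p-x (_ ∷ p) (F.suc x) (there x∈) = x∉p-x p x x∈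

∈p-y⇔∈p : ∀ {m} {p : Subset m} {x y} → x ≢ y → x ∈ₛ p - y ⇔ x ∈ₛ p
∈p-y⇔∈p {p = p} {y = y} x≢y = mk⇔ (p─q⊆p p ⁅ y ⁆) (λ x∈p → x∈p∧x≢y⇒x∈p-y x∈p x≢y)

∉p∪⁅y⁆⇔∉p : ∀ {m} {p : Subset m} {x y} → x ≢ y → x ∉ₛ p ∪ ⁅ y ⁆ ⇔ x ∉ₛ p
∉p∪⁅y⁆⇔∉p {p = p} {x} {y} x≢y = mk⇔ (λ x∉ x∈p → x∉ (p⊆p∪q ⁅ y ⁆ x∈p)) from
  where
    from : x ∉ₛ p → x ∉ₛ p ∪ ⁅ y ⁆
    from x∉p x∈ with x∈p∪q⁻ p ⁅ y ⁆ x∈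
    ... | inj₁ x∈p = x∉p x∈p
    ... | inj₂ x∈y = x≢y (x∈⁅y⁆⇒x≡y y x∈y)

∈p[x]≔true⁻ : ∀ {m} {p : Subset m} {x y} → y ∈ₛ p [ x ]≔ true → y ≡ x ⊎ y ∈ₛ p
∈p[x]≔true⁻ {p = _ ∷ p} {F.zero}  here       = inj₁ refl
∈p[x]≔true⁻ {p = _ ∷ p} {F.zero}  (there y∈) = inj₂ (there y∈)
∈p[x]≔true⁻ {p = _ ∷ p} {F.suc x} here       = inj₂ here
∈p[x]≔true⁻ {p = _ ∷ p} {F.suc x} (there y∈) with ∈p[x]≔true⁻ y∈
... | inj₁ refl = inj₁ refl
... | inj₂ y∈p  = inj₂ (there y∈p)

p⊂p[x]≔true : ∀ {m} {p : Subset m} {x} → x ∉ₛ p → p ⊂ p [ x ]≔ true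
p⊂p[x]≔true {p = p} {x} x∉p = ⊆ , x , []≔-updates p x , x∉p
  where
    ⊆ : p ⊆ p [ x ]≔ true
    ⊆ {y} y∈p with y F.≟ x
    ... | yes refl = []≔-updates p x
    ... | no y≢x   = []≔-minimal p y x y≢x y∈p

p⊂p∪⁅x⁆ : ∀ {m} {p : Subset m} {x} → x ∉ₛ p → p ⊂ p ∪ ⁅ x ⁆
p⊂p∪⁅x⁆ {p = p} {x} x∉p = p⊆p∪q ⁅ x ⁆ , x , q⊆p∪q p ⁅ x ⁆ (x∈⁅x⁆ x) , x∉p

∣∁∣-shrinks : ∀ {m} {p q : Subset m} → p ⊂ q → ∣ ∁ q ∣ < ∣ ∁ p ∣
∣∁∣-shrinks p⊂q = p⊂q⇒∣p∣<∣q∣ (p⊂q⇒∁p⊃∁q p⊂q)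

x∈p⇒∣p∣>0 : ∀ {m} {x : Fin m} {p} → x ∈ₛ p → 0 < ∣ p ∣
x∈p⇒∣p∣>0 {x = x} x∈p =
  subst (_≤ _) (∣⁅x⁆∣≡1 x) (p⊆q⇒∣p∣≤∣q∣ (λ y∈ → subst (_∈ₛ _) (sym (x∈⁅y⁆⇒x≡y x y∈)) x∈p))

infix 4 _≐_
_≐_ : ∀ {m} → Subset m → List (Fin m) → Set
L ≐ xs = ∀ a → a ∈ₛ L ⇔ a ∈ xs

≐-unique : ∀ {m} {L L′ : Subset m} {xs} → L ≐ xs → L′ ≐ xs → L ≡ L′
≐-unique L≐ L′≐ = ⊆-antisym (λ {a} → Equivalence.from (L′≐ a) ∘ Equivalence.to (L≐ a))
                            (λ {a} → Equivalence.from (L≐ a) ∘ Equivalence.to (L′≐ a))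

≐-remove : ∀ {m} {L : Subset m} {x xs} → L ≐ x ∷ xs → Unique (x ∷ xs) → L - x ≐ xs
≐-remove {L = L} {x} {xs} L≐ (x∉xs ∷ _) a = mk⇔ to from
  where
    to : a ∈ₛ L - x → a ∈ xs
    to a∈ with Equivalence.to (L≐ a) (p─q⊆p L ⁅ x ⁆ a∈)
    ... | here refl  = ⊥-elim (x∉p-x L x a∈)
    ... | there a∈xs = a∈xs
    from : a ∈ xs → a ∈ₛ L - x
    from a∈xs = x∈p∧x≢y⇒x∈p-y (Equivalence.from (L≐ a) (there a∈xs)) (λ { refl → All.lookup x∉xs a∈xs refl })

-- Reducts and stable models

module _ {n : ℕ} (P : Program n) where

  private
    reduce : Clause n → DefClause n
    reduce C = defclause (head C) (posBody C)

    applicable : Subset n → Clause n → Bool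
    applicable M C = all (λ a → not (a ∈ᵇ M)) (negBody C)

  reduct⁺ : ∀ {M C} → C ∈ P → All (_∉ₛ M) (negBody C) → reduce C ∈ reduct P M
  reduct⁺ {M} {C} C∈P neg∉M = ∈-map∘filter⁺ reduce (T? ∘ applicable M)
    (C , C∈P , refl , all⁻ _ (All.map (Equivalence.to ∉⇔T-not) neg∉M))

  reduct⁻ : ∀ {M D} → D ∈ reduct P M → ∃[ C ] C ∈ P × D ≡ reduce C × All (_∉ₛ M) (negBody C)
  reduct⁻ {M} D∈ with ∈-map∘filter⁻ reduce (T? ∘ applicable M) D∈
  ... | C , C∈P , refl , t = C , C∈P , refl , All.map (Equivalence.from ∉⇔T-not) (all⁺ _ _ t)

  reduct-antitone : ∀ {M M′} → M ⊆ M′ → ∀ {D} → D ∈ reduct P M′ → D ∈ reduct P M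
  reduct-antitone M⊆M′ D∈ with reduct⁻ D∈
  ... | C , C∈P , refl , neg∉M′ = reduct⁺ C∈P (All.map (λ a∉M′ → a∉M′ ∘ M⊆M′) neg∉M′)

  stable-antichain : ∀ {Y Z} → StableModel P Y → StableModel P Z → Y ⊆ Z → Y ≡ Z
  stable-antichain (Y-model , _) (_ , Z-least) Y⊆Z =
    ⊆-antisym Y⊆Z (Z-least _ (λ C C∈ → Y-model C (reduct-antitone Y⊆Z C∈)))

leastModel-unique : ∀ {n} {D : List (DefClause n)} {A B} → IsLeastModel D A → IsLeastModel D B → A ≡ B
leastModel-unique (A-model , A-least) (B-model , B-least) = ⊆-antisym (A-least _ B-model) (B-least _ A-model)

stable⇔leastModel≡ : ∀ {n} {P : Program n} {M L} → IsLeastModel (reduct P M) L → StableModel P M ⇔ L ≡ M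
stable⇔leastModel≡ L-least = mk⇔ (leastModel-unique L-least) (λ { refl → L-least })

length≤size : ∀ {n} (P : Program n) → length P ≤ size P
length≤size []      = z≤n
length≤size (C ∷ P) = s≤s (≤-trans (length≤size P) (m≤n+m _ _))

module _ {n : ℕ} (P : Program n) where

  posBodies≤size : sum (map (length ∘ posBody) P) ≤ size P
  posBodies≤size = sum-map-mono (λ C → m≤n⇒m≤1+n (m≤m+n _ _)) P

  negBodies≤size : sum (map (length ∘ negBody) P) ≤ size P
  negBodies≤size = sum-map-mono (λ C → m≤n⇒m≤1+n (m≤n+m _ _)) P

occurrences : ∀ {n} → Program n → List (Fin n)
occurrences []      = []
occurrences (C ∷ P) = (head C ∷ posBody C ++ negBody C) ++ occurrences P

length-occurrences : ∀ {n} (P : Program n) → length (occurrences P) ≡ size P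
length-occurrences []      = refl
length-occurrences (C ∷ P) = trans (List.length-++ (head C ∷ posBody C ++ negBody C))
  (cong₂ _+_ (cong suc (List.length-++ (posBody C))) (length-occurrences P))

Occurs⇒∈ : ∀ {n} {a : Fin n} P → Occurs a P → a ∈ occurrences P
Occurs⇒∈ (C ∷ P) (here (inj₁ refl))       = here refl
Occurs⇒∈ (C ∷ P) (here (inj₂ (inj₁ a∈))) = there (∈-++⁺ˡ (∈-++⁺ˡ a∈))
Occurs⇒∈ (C ∷ P) (here (inj₂ (inj₂ a∈))) = there (∈-++⁺ˡ (∈-++⁺ʳ (posBody C) a∈))
Occurs⇒∈ (C ∷ P) (there a∈)               = ∈-++⁺ʳ (head C ∷ posBody C ++ negBody C) (Occurs⇒∈ P a∈)

atoms≤size : ∀ {n} (P : Program n) → AtomsAre P → n ≤ size P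
atoms≤size P atoms = subst (_ ≤_) (length-occurrences P) (injective⇒≤ position-injective)
  where
    position : Fin _ → Fin (length (occurrences P))
    position a = Any.index (Occurs⇒∈ P (atoms a))
    position-injective : ∀ {a b} → position a ≡ position b → a ≡ b
    position-injective {a} {b} eq =
      trans (lookup-index (Occurs⇒∈ P (atoms a)))
            (trans (cong (lookup (occurrences P)) eq) (sym (lookup-index (Occurs⇒∈ P (atoms b)))))

linear-bound : ∀ {S n k a b u l} → n ≤ S → k ≤ S → a ≤ S → b ≤ S → u ≤ S → l ≤ S →
               5 * n + (S + n + k + (3 * a + 3 * b + 4 * u + 2 * l)) ≤ 20 * S
linear-bound {S} n≤ k≤ a≤ b≤ u≤ l≤ = ≤-trans
  (+-mono-≤ (*-monoʳ-≤ 5 n≤) (+-mono-≤ (+-mono-≤ (+-monoʳ-≤ S n≤) k≤)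
    (+-mono-≤ (+-mono-≤ (+-mono-≤ (*-monoʳ-≤ 3 a≤) (*-monoʳ-≤ 3 b≤)) (*-monoʳ-≤ 4 u≤)) (*-monoʳ-≤ 2 l≤))))
  (≤-reflexive (collect S))
  where
    collect : ∀ S → 5 * S + (S + S + S + (3 * S + 3 * S + 4 * S + 2 * S)) ≡ 20 * S
    collect = solve-∀

-- The invariant of stable_aux

module Analysis {n : ℕ} (P : Program n) (π : Permutation′ n) (sel : Selector (length P)) where
  open StableAux P π sel

  memᵇ⇒∈ : ∀ {a} xs → T (memᵇ a xs) → a ∈ xs
  memᵇ⇒∈ {a} (x ∷ xs) a∈ with a F.≟ x
  ... | yes a≡x = here a≡x
  ... | no  _   = there (memᵇ⇒∈ xs a∈)

  ∈⇒memᵇ : ∀ {a xs} → a ∈ xs → T (memᵇ a xs)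
  ∈⇒memᵇ {a} (here {x} a≡x) with a F.≟ x
  ... | yes _   = _
  ... | no  a≢x = ⊥-elim (a≢x a≡x)
  ∈⇒memᵇ {a} (there {x} a∈) with a F.≟ x
  ... | yes _ = _
  ... | no  _ = ∈⇒memᵇ a∈

  module _ (body : Clause n → List (Fin n)) {a : Fin n} where

    private
      occurs? : Fin k → Bool
      occurs? i = memᵇ a (body (cl i))

    ∈-occurrencesOf : ∀ {c} → c ∈ filterᵇ occurs? (allFin k) ⇔ a ∈ body (cl c)
    ∈-occurrencesOf = mk⇔ (memᵇ⇒∈ _ ∘ proj₂ ∘ ∈-filter⁻ (T? ∘ occurs?) {xs = allFin k})
                          (∈-filter⁺ (T? ∘ occurs?) (∈-allFin _) ∘ ∈⇒memᵇ)

    Unique-occurrencesOf : Unique (filterᵇ occurs? (allFin k))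
    Unique-occurrencesOf = Unique.filter⁺ _ (Unique.allFin⁺ k)

  ready⇔ : ∀ s c → T (ready s c) ⇔ (V.lookup (pc s) c ≡ 0 × V.lookup (nc s) c ≡ 0 × c ∉ₛ used s)
  ready⇔ s c = mk⇔ to from
    where
      to : T (ready s c) → V.lookup (pc s) c ≡ 0 × V.lookup (nc s) c ≡ 0 × c ∉ₛ used s
      to r with Equivalence.to T-∧ r
      ... | p0 , r′ with Equivalence.to T-∧ r′
      ... | n0 , u = ≡ᵇ⇒≡ _ 0 p0 , ≡ᵇ⇒≡ _ 0 n0 , Equivalence.from ∉⇔T-not u
      from : V.lookup (pc s) c ≡ 0 × V.lookup (nc s) c ≡ 0 × c ∉ₛ used s → T (ready s c)
      from (p0 , n0 , c∉) = Equivalence.from T-∧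
        (≡⇒≡ᵇ _ 0 p0 , Equivalence.from T-∧ (≡⇒≡ᵇ _ 0 n0 , Equivalence.to ∉⇔T-not c∉))

  Sound : Subset n → Subset n → Set
  Sound M L = ∀ N → IsModel (reduct P M) N → L ⊆ N

  Sound-antitone : ∀ {M M′ L} → M′ ⊆ M → Sound M L → Sound M′ L
  Sound-antitone M′⊆M L-sound N N-model = L-sound N (λ D D∈ → N-model D (reduct-antitone P M′⊆M D∈))

  QueueOK : State n k → Set
  QueueOK s = Unique (Q s) × (∀ c → c ∈ Q s ⇔ T (ready s c))

  record Invariant (s : State n k) : Set where
    field
      queue     : QueueOK s
      pc-counts : ∀ c → V.lookup (pc s) c ≡ count (λ a → ¬? (a ∈? lm s)) (posBody (cl c))
      nc-counts : ∀ c → V.lookup (nc s) c ≡ count (_∈? M s) (negBody (cl c))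
      fired     : ∀ {c} → c ∈ₛ used s → head (cl c) ∈ₛ lm s
      sound     : Sound (M s) (lm s)

  Invariant-cost : ∀ {s} c → Invariant s → Invariant (record s { cost = c })
  Invariant-cost _ inv = record
    { queue = queue ; pc-counts = pc-counts ; nc-counts = nc-counts ; fired = fired ; sound = sound }
    where open Invariant inv

  Φ : State n k → ℕ
  Φ s = 3 * V.sum (pc s) + 3 * V.sum (nc s) + 4 * ∣ ∁ (used s) ∣ + 2 * ∣ ∁ (lm s) ∣

  ∈⇒clause : ∀ {C} → C ∈ P → ∃[ c ] C ≡ cl c
  ∈⇒clause C∈P = Any.index C∈P , lookup-index C∈P

  module _ {s : State n k} (inv : Invariant s) where
    open Invariant inv

    pc≡0⇔ : ∀ {c} → V.lookup (pc s) c ≡ 0 ⇔ All (_∈ₛ lm s) (posBody (cl c))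
    pc≡0⇔ {c} = mk⇔
      (All.map (decidable-stable (_ ∈? lm s)) ∘ Equivalence.to (count≡0⇔ _ _) ∘ trans (sym (pc-counts c)))
      (trans (pc-counts c) ∘ Equivalence.from (count≡0⇔ _ _) ∘ All.map (λ a∈ a∉ → a∉ a∈))

    nc≡0⇔ : ∀ {c} → V.lookup (nc s) c ≡ 0 ⇔ All (_∉ₛ M s) (negBody (cl c))
    nc≡0⇔ {c} = mk⇔ (Equivalence.to (count≡0⇔ _ _) ∘ trans (sym (nc-counts c)))
                    (trans (nc-counts c) ∘ Equivalence.from (count≡0⇔ _ _))

    ready⇒sound : ∀ {c} → T (ready s c) → Sound (M s) (lm s ∪ ⁅ head (cl c) ⁆)
    ready⇒sound {c} c-ready N N-model x∈ with x∈p∪q⁻ (lm s) _ x∈ | Equivalence.to (ready⇔ s c) c-ready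
    ... | inj₁ x∈lm | _ = sound N N-model x∈lm
    ... | inj₂ x∈h  | p0 , n0 , _ rewrite x∈⁅y⁆⇒x≡y _ x∈h =
      N-model _ (reduct⁺ P (∈-lookup c) (Equivalence.to nc≡0⇔ n0))
        (λ a a∈ → sound N N-model (All.lookup (Equivalence.to pc≡0⇔ p0) a∈))

    empty⇒model : Q s ≡ [] → IsModel (reduct P (M s)) (lm s)
    empty⇒model Q≡[] D D∈ body⊆lm with reduct⁻ P D∈
    ... | C , C∈P , refl , neg∉M with ∈⇒clause C∈P
    ... | c , refl with c ∈? used s
    ...   | yes c∈used = fired c∈used
    ...   | no  c∉used = case subst (c ∈_) Q≡[] (Equivalence.from (proj₂ queue c) c-ready) of λ ()
      where
        c-ready : T (ready s c)
        c-ready = Equivalence.from (ready⇔ s c)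
          (Equivalence.from pc≡0⇔ (All.tabulate (body⊆lm _)) , Equivalence.from nc≡0⇔ neg∉M , c∉used)

    empty⇒leastModel : Q s ≡ [] → IsLeastModel (reduct P (M s)) (lm s)
    empty⇒leastModel Q≡[] = empty⇒model Q≡[] , sound

  -- Decrementing the counters

  addIf-frame : ∀ c s → addIf c s ≡ record s { Q = Q (addIf c s) }
  addIf-frame c s with ready s c
  ... | true  = refl
  ... | false = refl

  addIf-queue : ∀ {c s} → Unique (Q s) → c ∉ Q s →
                (∀ {c′} → c′ ≢ c → c′ ∈ Q s ⇔ T (ready s c′)) → QueueOK (addIf c s)
  addIf-queue {c} {s} u c∉Q others with ready s c in eq
  ... | true  = All.tabulate (λ c′∈ c≡c′ → c∉Q (subst (_∈ Q s) (sym c≡c′) c′∈)) ∷ u , member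
    where
      member : ∀ c′ → c′ ∈ c ∷ Q s ⇔ T (ready s c′)
      member c′ with c′ F.≟ c
      ... | yes refl = mk⇔ (λ _ → Equivalence.from T-≡ eq) (λ _ → here refl)
      ... | no c′≢c  = mk⇔ (λ { (here c′≡c) → ⊥-elim (c′≢c c′≡c) ; (there c′∈) → Equivalence.to (others c′≢c) c′∈ })
                           (there ∘ Equivalence.from (others c′≢c))
  ... | false = u , member
    where
      member : ∀ c′ → c′ ∈ Q s ⇔ T (ready s c′)
      member c′ with c′ F.≟ c
      ... | yes refl = mk⇔ (⊥-elim ∘ c∉Q) (λ r → ⊥-elim (subst T eq r))
      ... | no c′≢c  = others c′≢c

  data Counter : Set where
    pos neg : Counter

  choose : Counter → A → A → A
  choose pos a _ = a
  choose neg _ b = b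

  opposite : Counter → Counter
  opposite pos = neg
  opposite neg = pos

  counter : Counter → State n k → Vec ℕ k
  counter w s = choose w (pc s) (nc s)

  decrementAt : Counter → Fin k → State n k → State n k
  decrementAt w c s = record s
    { pc   = choose w (updateAt (pc s) c (_∸ 1)) (pc s)
    ; nc   = choose w (nc s) (updateAt (nc s) c (_∸ 1))
    ; cost = 3 + cost s }

  decrements : Counter → List (Fin k) → State n k → State n k
  decrements w []       s = record s { cost = suc (cost s) }
  decrements w (c ∷ cs) s = decrements w cs (addIf c (decrementAt w c s))

  decPos≡decrements : ∀ cs s → decPos cs s ≡ decrements pos cs s
  decPos≡decrements []       s = refl
  decPos≡decrements (c ∷ cs) s = decPos≡decrements cs _

  decNeg≡decrements : ∀ cs s → decNeg cs s ≡ decrements neg cs s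
  decNeg≡decrements []       s = refl
  decNeg≡decrements (c ∷ cs) s = decNeg≡decrements cs _

  module _ {c : Fin k} {s : State n k} where

    counter-decrementAt : ∀ w → counter w (decrementAt w c s) ≡ updateAt (counter w s) c (_∸ 1)
    counter-decrementAt pos = refl
    counter-decrementAt neg = refl

    opposite-decrementAt : ∀ w → counter (opposite w) (decrementAt w c s) ≡ counter (opposite w) s
    opposite-decrementAt pos = refl
    opposite-decrementAt neg = refl

    ready-decrementAt : ∀ w {c′} → c′ ≢ c → ready (decrementAt w c s) c′ ≡ ready s c′
    ready-decrementAt pos {c′} c′≢c = cong (λ x → zeroᵇ x ∧ zeroᵇ (V.lookup (nc s) c′) ∧ not (V.lookup (used s) c′))
                                           (lookup∘updateAt′ c′ c c′≢c (pc s))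
    ready-decrementAt neg {c′} c′≢c = cong (λ x → zeroᵇ (V.lookup (pc s) c′) ∧ zeroᵇ x ∧ not (V.lookup (used s) c′))
                                           (lookup∘updateAt′ c′ c c′≢c (nc s))

    ready⇒counter≡0 : ∀ w → T (ready s c) → V.lookup (counter w s) c ≡ 0
    ready⇒counter≡0 pos = proj₁ ∘ Equivalence.to (ready⇔ s c)
    ready⇒counter≡0 neg = proj₁ ∘ proj₂ ∘ Equivalence.to (ready⇔ s c)

    decrementAt-potential : ∀ w → V.lookup (counter w s) c ≢ 0 →
                            cost (decrementAt w c s) + Φ (decrementAt w c s) ≡ cost s + Φ s
    decrementAt-potential pos nz rewrite sum-decrement (pc s) c nz =
      shift (cost s) (V.sum (updateAt (pc s) c (_∸ 1))) (V.sum (nc s)) ∣ ∁ (used s) ∣ ∣ ∁ (lm s) ∣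
      where
        shift : ∀ t p q u l → 3 + t + (3 * p + 3 * q + 4 * u + 2 * l) ≡ t + (3 * suc p + 3 * q + 4 * u + 2 * l)
        shift = solve-∀
    decrementAt-potential neg nz rewrite sum-decrement (nc s) c nz =
      shift (cost s) (V.sum (pc s)) (V.sum (updateAt (nc s) c (_∸ 1))) ∣ ∁ (used s) ∣ ∣ ∁ (lm s) ∣
      where
        shift : ∀ t p q u l → 3 + t + (3 * p + 3 * q + 4 * u + 2 * l) ≡ t + (3 * p + 3 * suc q + 4 * u + 2 * l)
        shift = solve-∀

  record Unchanged (w : Counter) (s s′ : State n k) : Set where
    field
      opposite≡ : counter (opposite w) s′ ≡ counter (opposite w) s
      used≡     : used s′ ≡ used s
      lm≡       : lm s′ ≡ lm s
      M≡        : M s′ ≡ M s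

  Unchanged-trans : ∀ {w s₁ s₂ s₃} → Unchanged w s₁ s₂ → Unchanged w s₂ s₃ → Unchanged w s₁ s₃
  Unchanged-trans u v = record
    { opposite≡ = trans (opposite≡ v) (opposite≡ u) ; used≡ = trans (used≡ v) (used≡ u)
    ; lm≡ = trans (lm≡ v) (lm≡ u) ; M≡ = trans (M≡ v) (M≡ u) }
    where open Unchanged

  module DecrementStep (w : Counter) (c : Fin k) (s : State n k) where

    s′ : State n k
    s′ = addIf c (decrementAt w c s)

    private
      frame : s′ ≡ record (decrementAt w c s) { Q = Q s′ }
      frame = addIf-frame c (decrementAt w c s)

    counter≡ : ∀ c′ → V.lookup (counter w s′) c′ ≡ V.lookup (updateAt (counter w s) c (_∸ 1)) c′
    counter≡ c′ = cong (λ v → V.lookup v c′) (trans (cong (counter w) frame) (counter-decrementAt {c} {s} w))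

    unchanged : Unchanged w s s′
    unchanged = record
      { opposite≡ = trans (cong (counter (opposite w)) frame) (opposite-decrementAt {c} {s} w)
      ; used≡ = cong used frame ; lm≡ = cong lm frame ; M≡ = cong M frame }

    module _ (nonzero : V.lookup (counter w s) c ≢ 0) where

      queue : QueueOK s → QueueOK s′
      queue (uniq , member) = addIf-queue {c} {decrementAt w c s} uniq
        (λ c∈Q → nonzero (ready⇒counter≡0 {c} {s} w (Equivalence.to (member c) c∈Q)))
        (λ {c′} c′≢c → subst (λ b → c′ ∈ Q s ⇔ T b) (sym (ready-decrementAt {c} {s} w c′≢c)) (member c′))

      potential : cost s′ + Φ s′ ≡ cost s + Φ s
      potential = trans (cong (λ s″ → cost s″ + Φ s″) frame) (decrementAt-potential {c} {s} w nonzero)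

  record Decremented (w : Counter) (goal : Fin k → ℕ) (s s′ : State n k) : Set where
    field
      queue     : QueueOK s′
      reached   : ∀ c → V.lookup (counter w s′) c ≡ goal c
      unchanged : Unchanged w s s′
      potential : cost s′ + Φ s′ ≡ suc (cost s + Φ s)

  decrements-spec : ∀ w cs {s} (goal : Fin k → ℕ) → Unique cs →
                    (∀ c → c ∈ cs → V.lookup (counter w s) c ≡ suc (goal c)) →
                    (∀ c → c ∉ cs → V.lookup (counter w s) c ≡ goal c) →
                    QueueOK s → Decremented w goal s (decrements w cs s)
  decrements-spec w [] goal _ _ outside q = record
    { queue = q ; reached = λ c → outside c λ () ; potential = refl
    ; unchanged = record { opposite≡ = refl ; used≡ = refl ; lm≡ = refl ; M≡ = refl } }
  decrements-spec w (c ∷ cs) {s} goal (c∉cs ∷ u) inside outside q = record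
    { queue     = Rest.queue
    ; reached   = Rest.reached
    ; unchanged = Unchanged-trans Step.unchanged Rest.unchanged
    ; potential = trans Rest.potential (cong suc (Step.potential nonzero)) }
    where
      module Step = DecrementStep w c s

      nonzero : V.lookup (counter w s) c ≢ 0
      nonzero = subst (_≢ 0) (sym (inside c (here refl))) λ ()

      inside′ : ∀ c′ → c′ ∈ cs → V.lookup (counter w Step.s′) c′ ≡ suc (goal c′)
      inside′ c′ c′∈cs = trans (Step.counter≡ c′) (trans
        (lookup∘updateAt′ c′ c (λ { refl → All.lookup c∉cs c′∈cs refl }) (counter w s))
        (inside c′ (there c′∈cs)))

      outside′ : ∀ c′ → c′ ∉ cs → V.lookup (counter w Step.s′) c′ ≡ goal c′
      outside′ c′ c′∉cs with c′ F.≟ c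
      ... | yes refl = trans (Step.counter≡ c) (trans (lookup∘updateAt c (counter w s))
                         (cong (_∸ 1) (inside c (here refl))))
      ... | no c′≢c  = trans (Step.counter≡ c′) (trans (lookup∘updateAt′ c′ c c′≢c (counter w s))
                         (outside c′ λ { (here c′≡c) → c′≢c c′≡c ; (there c′∈) → c′∉cs c′∈ }))

      rest : Decremented w goal Step.s′ (decrements w cs Step.s′)
      rest = decrements-spec w cs goal u inside′ outside′ (Step.queue nonzero q)

      module Rest = Decremented rest

  -- The inner loop

  private
    used-step : ∀ t a u₁ u l → u₁ < u → 4 + t + (a + 4 * u₁ + l) ≤ t + (a + 4 * u + l)
    used-step t a u₁ u l u₁<u = begin
      4 + t + (a + 4 * u₁ + l)  ≡⟨ shift t a u₁ l ⟩
      t + (a + 4 * suc u₁ + l)  ≤⟨ +-monoʳ-≤ t (+-monoˡ-≤ l (+-monoʳ-≤ a (*-monoʳ-≤ 4 u₁<u))) ⟩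
      t + (a + 4 * u + l)       ∎
      where
        open ≤-Reasoning
        shift : ∀ t a u l → 4 + t + (a + 4 * u + l) ≡ t + (a + 4 * suc u + l)
        shift = solve-∀

    lm-step : ∀ t a l₁ l → l₁ < l → 2 + t + (a + 2 * l₁) ≤ t + (a + 2 * l)
    lm-step t a l₁ l l₁<l = begin
      2 + t + (a + 2 * l₁)  ≡⟨ shift t a l₁ ⟩
      t + (a + 2 * suc l₁)  ≤⟨ +-monoʳ-≤ t (+-monoʳ-≤ a (*-monoʳ-≤ 2 l₁<l)) ⟩
      t + (a + 2 * l)       ∎
      where
        open ≤-Reasoning
        shift : ∀ t a l → 2 + t + (a + 2 * l) ≡ t + (a + 2 * suc l)
        shift = solve-∀

  module Pop {s : State n k} (inv : Invariant s) {x xs} (Q≡ : Q s ≡ x ∷ xs) where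
    open Invariant inv

    i : Fin (length (x ∷ xs))
    i = sel (t s) x xs

    c₀ : Fin k
    c₀ = lookup (x ∷ xs) i

    h : Fin n
    h = head (cl c₀)

    s₁ : State n k
    s₁ = record s { Q = removeAt (x ∷ xs) i ; used = used s [ c₀ ]≔ true ; t = suc (t s) ; cost = 4 + cost s }

    s₂ : State n k
    s₂ = record s₁ { lm = lm s ∪ ⁅ h ⁆ ; cost = suc (cost s₁) }

    s₃ : State n k
    s₃ = decPos (posOf h) s₂

    c₀-ready : T (ready s c₀)
    c₀-ready = Equivalence.to (proj₂ queue c₀) (subst (c₀ ∈_) (sym Q≡) (∈-lookup i))

    c₀∉used : c₀ ∉ₛ used s
    c₀∉used = proj₂ (proj₂ (Equivalence.to (ready⇔ s c₀) c₀-ready))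

    used-shrinks : ∣ ∁ (used s₁) ∣ < ∣ ∁ (used s) ∣
    used-shrinks = ∣∁∣-shrinks (p⊂p[x]≔true c₀∉used)

    queue₁ : QueueOK s₁
    queue₁ = Unique-removeAt i uniq , member
      where
        uniq : Unique (x ∷ xs)
        uniq = subst Unique Q≡ (proj₁ queue)
        member : ∀ c → c ∈ removeAt (x ∷ xs) i ⇔ T (ready s₁ c)
        member c with c F.≟ c₀
        ... | yes refl = mk⇔ (⊥-elim ∘ lookup∉removeAt i uniq)
                             (λ r → ⊥-elim (proj₂ (proj₂ (Equivalence.to (ready⇔ s₁ c₀) r)) ([]≔-updates (used s) c₀)))
        ... | no c≢c₀  = subst (λ b → c ∈ removeAt (x ∷ xs) i ⇔ T b) (sym ready≡) (mk⇔
              (Equivalence.to (proj₂ queue c) ∘ subst (c ∈_) (sym Q≡) ∘ ∈-removeAt⁻ (x ∷ xs) i)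
              (λ r → ∈-removeAt⁺ (x ∷ xs) i (subst (c ∈_) Q≡ (Equivalence.from (proj₂ queue c) r)) c≢c₀))
          where
            ready≡ : ready s₁ c ≡ ready s c
            ready≡ = cong (λ b → zeroᵇ (V.lookup (pc s) c) ∧ zeroᵇ (V.lookup (nc s) c) ∧ not b)
                          (lookup∘updateAt′ c c₀ c≢c₀ (used s))

    fired₁ : ∀ {L} → lm s ⊆ L → h ∈ₛ L → ∀ {c} → c ∈ₛ used s₁ → head (cl c) ∈ₛ L
    fired₁ lm⊆L h∈L c∈ with ∈p[x]≔true⁻ c∈
    ... | inj₁ refl   = h∈L
    ... | inj₂ c∈used = lm⊆L (fired c∈used)

    potential₁ : cost s₁ + Φ s₁ ≤ cost s + Φ s
    potential₁ = used-step (cost s) (3 * V.sum (pc s) + 3 * V.sum (nc s)) _ _ (2 * ∣ ∁ (lm s) ∣) used-shrinks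

    invariant₁ : h ∈ₛ lm s → Invariant s₁
    invariant₁ h∈lm = record
      { queue = queue₁ ; pc-counts = pc-counts ; nc-counts = nc-counts
      ; fired = fired₁ (λ x∈ → x∈) h∈lm ; sound = sound }

    module Fresh (h∉lm : h ∉ₛ lm s) where

      decremented : Decremented pos (λ c → count (λ a → ¬? (a ∈? lm s₂)) (posBody (cl c))) s₂ s₃
      decremented = subst (Decremented pos _ s₂) (sym (decPos≡decrements (posOf h) s₂))
        (decrements-spec pos (posOf h) _ (Unique-occurrencesOf posBody {h})
          (λ c c∈ → trans (pc-counts c) (count-drop _ _ agree h∉lm (λ h∉ → h∉ (q⊆p∪q (lm s) _ (x∈⁅x⁆ h)))
                           (posUniq (cl c)) (Equivalence.to (∈-occurrencesOf posBody {h}) c∈)))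
          (λ c c∉ → trans (pc-counts c) (count-agree _ _ agree (c∉ ∘ Equivalence.from (∈-occurrencesOf posBody {h}))))
          queue₁)
        where
          agree : ∀ {a} → a ≢ h → a ∉ₛ lm s ⇔ a ∉ₛ lm s ∪ ⁅ h ⁆
          agree = ⇔.sym ∘ ∉p∪⁅y⁆⇔∉p

      open Decremented decremented using (reached; unchanged)
      open Unchanged unchanged public using (used≡; M≡)
      open Unchanged unchanged using (opposite≡; lm≡)

      invariant₃ : Invariant s₃
      invariant₃ = record
        { queue     = Decremented.queue decremented
        ; pc-counts = λ c → trans (reached c) (cong (λ L → count (λ a → ¬? (a ∈? L)) (posBody (cl c))) (sym lm≡))
        ; nc-counts = λ c → trans (cong (λ v → V.lookup v c) opposite≡)
                                  (trans (nc-counts c) (cong (λ M′ → count (_∈? M′) (negBody (cl c))) (sym M≡)))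
        ; fired     = λ c∈ → subst (_ ∈ₛ_) (sym lm≡)
                        (fired₁ (p⊆p∪q ⁅ h ⁆) (q⊆p∪q (lm s) ⁅ h ⁆ (x∈⁅x⁆ h)) (subst (_ ∈ₛ_) used≡ c∈))
        ; sound     = subst₂ Sound (sym M≡) (sym lm≡) (ready⇒sound inv c₀-ready) }

      potential₃ : cost s₃ + Φ s₃ ≤ cost s + Φ s
      potential₃ = begin
        cost s₃ + Φ s₃        ≡⟨ Decremented.potential decremented ⟩
        suc (cost s₂ + Φ s₂)  ≤⟨ lm-step (cost s₁) (3 * V.sum (pc s) + 3 * V.sum (nc s) + 4 * ∣ ∁ (used s₁) ∣) _ _
                                         (∣∁∣-shrinks (p⊂p∪⁅x⁆ h∉lm)) ⟩
        cost s₁ + Φ s₁        ≤⟨ potential₁ ⟩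
        cost s + Φ s          ∎
        where open ≤-Reasoning

  record Drained (s s′ : State n k) : Set where
    field
      invariant : Invariant s′
      empty     : Q s′ ≡ []
      M≡        : M s′ ≡ M s
      potential : cost s′ + Φ s′ ≤ suc (cost s + Φ s)

  -- The fuel never runs out, as every pop marks a new clause as used and Q holds only unused clauses.
  whileQ-drains : ∀ f s → Invariant s → ∣ ∁ (used s) ∣ ≤ f → Drained s (whileQ f s)
  whileQ-drains zero s inv fuel = record { invariant = inv ; empty = empty ; M≡ = refl ; potential = n≤1+n _ }
    where
      empty : Q s ≡ []
      empty with Q s in Q≡
      ... | []    = refl
      ... | c ∷ _ = case <-≤-trans (x∈p⇒∣p∣>0 (x∉p⇒x∈∁p c∉used)) fuel of λ ()
        where
          c∉used : c ∉ₛ used s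
          c∉used = proj₂ (proj₂ (Equivalence.to (ready⇔ s c)
                     (Equivalence.to (proj₂ (Invariant.queue inv) c) (subst (c ∈_) (sym Q≡) (here refl)))))
  whileQ-drains (suc f) s inv fuel with Q s in Q≡
  ... | []     = record { invariant = Invariant-cost _ inv ; empty = Q≡ ; M≡ = refl ; potential = ≤-refl }
  ... | x ∷ xs = step
    where
      open Pop inv Q≡

      fuel₁ : ∣ ∁ (used s₁) ∣ ≤ f
      fuel₁ = s≤s⁻¹ (≤-trans used-shrinks fuel)

      step : Drained s (if h ∈ᵇ lm s₁ then whileQ f s₁ else whileQ f s₃)
      step with h ∈ᵇ lm s₁ in h∈lm
      ... | true = record { invariant = invariant ; empty = empty ; M≡ = M≡
                          ; potential = ≤-trans potential (s≤s potential₁) }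
        where open Drained (whileQ-drains f s₁ (invariant₁ (lookup⇒[]= h (lm s) h∈lm)) fuel₁)
      ... | false = record { invariant = invariant ; empty = empty ; M≡ = trans M≡ H.M≡
                           ; potential = ≤-trans potential (s≤s H.potential₃) }
        where
          h∉lm : h ∉ₛ lm s
          h∉lm h∈ = case trans (sym h∈lm) ([]=⇒lookup h∈) of λ ()
          module H = Fresh h∉lm
          open Drained (whileQ-drains f s₃ H.invariant₃ (subst (λ u → ∣ ∁ u ∣ ≤ f) (sym H.used≡) fuel₁))

  -- The outer loop

  _≟ₛ_ : (L L′ : Subset n) → Dec (L ≡ L′)
  _≟ₛ_ = ≡-dec Bool._≟_

  data RoundView (x : Fin n) (xs : List (Fin n)) (s : State n k) : Set where
    stops     : StableModel P (M s) → ∀ {steps} → forLoop (x ∷ xs) s ≡ (just (M s) , steps) →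
                steps ≤ 5 + (cost s + Φ s) → RoundView x xs s
    continues : ¬ StableModel P (M s) → ∀ {s′} → forLoop (x ∷ xs) s ≡ forLoop xs s′ →
                Invariant s′ → M s′ ≐ xs → cost s′ + Φ s′ ≤ 5 + (cost s + Φ s) → RoundView x xs s

  module Round {s : State n k} (inv : Invariant s) {x xs} (M≐ : M s ≐ x ∷ xs) (uniq : Unique (x ∷ xs)) where

    s₀ : State n k
    s₀ = record s { cost = suc (cost s) }

    s₁ : State n k
    s₁ = whileQ k s₀

    s₃ : State n k
    s₃ = record s₁ { M = M s₁ - x ; cost = 2 + cost s₁ }

    s₄ : State n k
    s₄ = decNeg (negOf x) s₃

    drained : Drained s₀ s₁
    drained = whileQ-drains k s₀ (Invariant-cost (suc (cost s)) inv) (∣p∣≤n (∁ (used s)))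

    module W = Drained drained
    open Invariant W.invariant

    stable⇔ : StableModel P (M s) ⇔ lm s₁ ≡ M s₁
    stable⇔ = subst (λ M′ → StableModel P M′ ⇔ lm s₁ ≡ M s₁) W.M≡
                    (stable⇔leastModel≡ {P = P} (empty⇒leastModel W.invariant W.empty))

    x∈M₁ : x ∈ₛ M s₁
    x∈M₁ = subst (x ∈ₛ_) (sym W.M≡) (Equivalence.from (M≐ x) (here refl))

    decremented : Decremented neg (λ c → count (_∈? M s₃) (negBody (cl c))) s₃ s₄
    decremented = subst (Decremented neg _ s₃) (sym (decNeg≡decrements (negOf x) s₃))
      (decrements-spec neg (negOf x) _ (Unique-occurrencesOf negBody {x})
        (λ c c∈ → trans (nc-counts c) (count-drop _ _ agree x∈M₁ (x∉p-x (M s₁) x)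
                         (negUniq (cl c)) (Equivalence.to (∈-occurrencesOf negBody {x}) c∈)))
        (λ c c∉ → trans (nc-counts c) (count-agree _ _ agree (c∉ ∘ Equivalence.from (∈-occurrencesOf negBody {x}))))
        queue)
      where
        agree : ∀ {a} → a ≢ x → a ∈ₛ M s₁ ⇔ a ∈ₛ M s₁ - x
        agree = ⇔.sym ∘ ∈p-y⇔∈p

    open Decremented decremented using (reached; unchanged)
    open Unchanged unchanged

    invariant₄ : Invariant s₄
    invariant₄ = record
      { queue     = Decremented.queue decremented
      ; pc-counts = λ c → trans (cong (λ v → V.lookup v c) opposite≡)
                                (trans (pc-counts c) (cong (λ L → count (λ a → ¬? (a ∈? L)) (posBody (cl c))) (sym lm≡)))
      ; nc-counts = λ c → trans (reached c) (cong (λ M′ → count (_∈? M′) (negBody (cl c))) (sym M≡))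
      ; fired     = λ c∈ → subst (_ ∈ₛ_) (sym lm≡) (fired (subst (_ ∈ₛ_) used≡ c∈))
      ; sound     = subst₂ Sound (sym M≡) (sym lm≡) (Sound-antitone (p─q⊆p (M s₁) ⁅ x ⁆) sound) }

    M₄≐ : M s₄ ≐ xs
    M₄≐ = subst (_≐ xs) (sym (trans M≡ (cong (_- x) W.M≡))) (≐-remove M≐ uniq)

    potential₄ : cost s₄ + Φ s₄ ≤ 5 + (cost s + Φ s)
    potential₄ rewrite Decremented.potential decremented = s≤s (s≤s (s≤s W.potential))

    round : RoundView x xs s
    round with lm s₁ ≟ₛ M s₁
    ... | yes lm≡M = stops (Equivalence.from stable⇔ lm≡M)
      (cong₂ (λ b L → if b then (just L , suc (cost s₁)) else forLoop xs s₄) (dec-true (lm s₁ ≟ₛ M s₁) lm≡M) W.M≡)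
      (≤-trans (s≤s (≤-trans (m≤m+n _ _) W.potential)) (m≤n+m _ 2))
    ... | no lm≢M = continues (lm≢M ∘ Equivalence.to stable⇔)
      (cong (λ b → if b then (just (M s₁) , suc (cost s₁)) else forLoop xs s₄) (dec-false (lm s₁ ≟ₛ M s₁) lm≢M))
      invariant₄ M₄≐ potential₄

  forLoop-sound : ∀ xs s → Invariant s → M s ≐ xs → Unique xs →
                  ∀ {Z} → proj₁ (forLoop xs s) ≡ just Z → StableModel P Z
  forLoop-sound (x ∷ xs) s inv M≐ uniq@(_ ∷ uniq′) out with Round.round inv M≐ uniq
  ... | stops stable eq _ = subst (StableModel P) (just-injective (trans (sym (cong proj₁ eq)) out)) stable
  ... | continues _ eq inv′ M≐′ _ = forLoop-sound xs _ inv′ M≐′ uniq′ (trans (sym (cong proj₁ eq)) out)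

  forLoop-complete : ∀ xs s → Invariant s → M s ≐ xs → Unique xs →
                     ∀ {Y} → StableModel P Y → ∀ i → i < length xs → Y ≐ drop i xs →
                     proj₁ (forLoop xs s) ≡ just Y
  forLoop-complete (x ∷ xs) s inv M≐ uniq@(_ ∷ uniq′) {Y} Y-stable i i< Y≐ with Round.round inv M≐ uniq
  ... | stops stable eq _ = trans (cong proj₁ eq) (cong just (sym (stable-antichain P Y-stable stable Y⊆M)))
    where
      Y⊆M : Y ⊆ M s
      Y⊆M {a} = Equivalence.from (M≐ a) ∘ ∈-drop⁻ i (x ∷ xs) ∘ Equivalence.to (Y≐ a)
  ... | continues unstable eq inv′ M≐′ _ with i
  ...   | zero  = ⊥-elim (unstable (subst (StableModel P) (≐-unique Y≐ M≐) Y-stable))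
  ...   | suc i = trans (cong proj₁ eq) (forLoop-complete xs _ inv′ M≐′ uniq′ Y-stable i (s≤s⁻¹ i<) Y≐)

  forLoop-cost : ∀ xs s → Invariant s → M s ≐ xs → Unique xs →
                 proj₂ (forLoop xs s) ≤ 5 * length xs + (cost s + Φ s)
  forLoop-cost []       s _ _ _ = m≤m+n (cost s) (Φ s)
  forLoop-cost (x ∷ xs) s inv M≐ uniq@(_ ∷ uniq′) with Round.round inv M≐ uniq
  ... | stops _ eq bound =
    subst (_≤ _) (sym (cong proj₂ eq)) (≤-trans bound (+-monoˡ-≤ (cost s + Φ s) (m≤m*n 5 (suc (length xs)))))
  ... | continues _ {s′} eq inv′ M≐′ bound = subst (_≤ _) (sym (cong proj₂ eq)) (begin
    proj₂ (forLoop xs s′)                 ≤⟨ forLoop-cost xs s′ inv′ M≐′ uniq′ ⟩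
    5 * length xs + (cost s′ + Φ s′)      ≤⟨ +-monoʳ-≤ (5 * length xs) bound ⟩
    5 * length xs + (5 + (cost s + Φ s))  ≡⟨ shift (length xs) (cost s + Φ s) ⟩
    5 * suc (length xs) + (cost s + Φ s)  ∎)
    where
      open ≤-Reasoning
      shift : ∀ l c → 5 * l + (5 + c) ≡ 5 * suc l + c
      shift = solve-∀

  initial-invariant : Invariant initState
  initial-invariant = record
    { queue     = Unique.filter⁺ _ (Unique.allFin⁺ k) , member
    ; pc-counts = λ c → trans (lookup∘tabulate _ c) (sym (count-all _ {posBody (cl c)} (All.tabulate λ _ → ∉⊥)))
    ; nc-counts = λ c → trans (lookup∘tabulate _ c) (sym (count-all _ {negBody (cl c)} (All.tabulate λ _ → ∈⊤)))
    ; fired     = ⊥-elim ∘ ∉⊥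
    ; sound     = λ _ _ → ⊥⊆ }
    where
      empty-body : Fin k → Bool
      empty-body c = zeroᵇ (length (posBody (cl c))) ∧ zeroᵇ (length (negBody (cl c)))

      ready≡ : ∀ c → ready initState c ≡ empty-body c
      ready≡ c = cong₂ (λ a b → zeroᵇ a ∧ b) (lookup∘tabulate _ c)
        (trans (cong₂ (λ a b → zeroᵇ a ∧ not b) (lookup∘tabulate _ c) (lookup-replicate c false)) (∧-identityʳ _))

      member : ∀ c → c ∈ Q initState ⇔ T (ready initState c)
      member c = subst (λ b → c ∈ Q initState ⇔ T b) (sym (ready≡ c))
        (mk⇔ (proj₂ ∘ ∈-filter⁻ (T? ∘ empty-body) {xs = allFin k}) (∈-filter⁺ (T? ∘ empty-body) (∈-allFin c)))

  schedule : List (Fin n)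
  schedule = map (π ⟨$⟩ʳ_) (allFin n)

  Unique-schedule : Unique schedule
  Unique-schedule =
    Unique.map⁺ (λ eq → trans (sym (inverseˡ π)) (trans (cong (π ⟨$⟩ˡ_) eq) (inverseˡ π))) (Unique.allFin⁺ n)

  length-schedule : length schedule ≡ n
  length-schedule = trans (List.length-map _ (allFin n)) (List.length-tabulate (λ x → x))

  ⊤≐schedule : ⊤ ≐ schedule
  ⊤≐schedule a = mk⇔ (λ _ → subst (_∈ schedule) (inverseʳ π) (∈-map⁺ (π ⟨$⟩ʳ_) (∈-allFin (π ⟨$⟩ˡ a))))
                     (λ _ → ∈⊤)

  suffixSet≐drop : ∀ j → suffixSet π j ≐ drop (toℕ j) schedule
  suffixSet≐drop j a = mk⇔ to from
    where
      ∈suffix⇔ : a ∈ₛ suffixSet π j ⇔ T (toℕ j ≤ᵇ toℕ (π ⟨$⟩ˡ a))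
      ∈suffix⇔ = subst (λ b → a ∈ₛ suffixSet π j ⇔ T b) (lookup∘tabulate _ a) ∈⇔T

      to : a ∈ₛ suffixSet π j → a ∈ drop (toℕ j) schedule
      to a∈ = subst (a ∈_) (sym (List.drop-map (toℕ j) (allFin n)))
        (subst (_∈ _) (inverseʳ π) (∈-map⁺ (π ⟨$⟩ʳ_)
          (∈-drop-allFin⁺ (toℕ j) (≤ᵇ⇒≤ _ _ (Equivalence.to ∈suffix⇔ a∈)))))

      from : a ∈ drop (toℕ j) schedule → a ∈ₛ suffixSet π j
      from a∈ with ∈-map⁻ (π ⟨$⟩ʳ_) (subst (a ∈_) (List.drop-map (toℕ j) (allFin n)) a∈)
      ... | b , b∈ , refl = Equivalence.from ∈suffix⇔
        (≤⇒≤ᵇ (subst (toℕ j ≤_) (cong toℕ (sym (inverseˡ π))) (∈-drop-allFin⁻ (toℕ j) b∈)))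

  run-correct : ∀ j → proj₁ run ≡ just (suffixSet π j) ⇔ StableModel P (suffixSet π j)
  run-correct j = mk⇔
    (forLoop-sound schedule initState initial-invariant ⊤≐schedule Unique-schedule)
    (λ stable → forLoop-complete schedule initState initial-invariant ⊤≐schedule Unique-schedule stable (toℕ j)
                  (subst (toℕ j <_) (sym length-schedule) (toℕ<n j)) (suffixSet≐drop j))

  run-linear : AtomsAre P → proj₂ run ≤ 20 * size P
  run-linear atoms = begin
    proj₂ run                                               ≤⟨ forLoop-cost schedule initState initial-invariant
                                                                 ⊤≐schedule Unique-schedule ⟩
    5 * length schedule + (cost initState + Φ initState)    ≡⟨ cong (λ l → 5 * l + (cost initState + Φ initState))
                                                                    length-schedule ⟩
    5 * n + (cost initState + Φ initState)                  ≤⟨ linear-bound (atoms≤size P atoms) (length≤size P)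
      (≤-trans (≤-reflexive (sum-tabulate-lookup (length ∘ posBody) P)) (posBodies≤size P))
      (≤-trans (≤-reflexive (sum-tabulate-lookup (length ∘ negBody) P)) (negBodies≤size P))
      (≤-trans (∣p∣≤n (∁ (used initState))) (length≤size P))
      (≤-trans (∣p∣≤n (∁ (lm initState))) (atoms≤size P atoms)) ⟩
    20 * size P                                             ∎
    where open ≤-Reasoning

proposition4 :
    ((n : ℕ) (P : Program n) → Unique P → AtomsAre P →
      (π : Permutation′ n) (sel : Selector (length P)) (j : Fin n) →
      (proj₁ (stable-aux P π sel) ≡ just (suffixSet π j)) ⇔ StableModel P (suffixSet π j))
    ×
    (∃[ c ] ((n : ℕ) (P : Program n) → Unique P → AtomsAre P →
      (π : Permutation′ n) (sel : Selector (length P)) →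
      proj₂ (stable-aux P π sel) ≤ c * size P))
proposition4 =
    (λ n P _ _ π sel → Analysis.run-correct P π sel)
  , 20 , λ n P _ atoms π sel → Analysis.run-linear P π sel atoms
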